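{- For every integer $k \geq 6$, $f(k) \geq 2k+2$. That is, every simple graph $G$ that contains every simple graph on $k$ vertices as an induced subgraph (up to isomorphism) has at least $2k+2$ vertices.
   Context: All graphs are finite and simple. A graph $G$ is induced universal for a family $\mathcal{F}$ of graphs if every member of $\mathcal{F}$ is isomorphic to an induced subgraph of $G$. $\mathcal{F}(k)$ denotes the family of all graphs on $k$ vertices, and $f(k)$ denotes the minimum number of vertices of a graph that is induced universal for $\mathcal{F}(k)$. -}

module Defs where

open import Data.Nat using (ℕ)
open import Data.Fin using (Fin)
open import Data.Bool using (Bool; false)
open import Data.Product using (Σ; _×_)
open import Relation.Binary.PropositionalEquality using (_≡_)
open import Function.Definitions using (Injective)

record Graph (n : ℕ) : Set where
  field
    adj   : Fin n → Fin n → Bool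
    sym   : ∀ u v → adj u v ≡ adj v u
    irrefl : ∀ v → adj v v ≡ false
open Graph public

record InducedEmbedding {k n : ℕ} (H : Graph k) (G : Graph n) : Set where
  field
    map       : Fin k → Fin n
    injective : Injective _≡_ _≡_ map
    preserves : ∀ u v → adj G (map u) (map v) ≡ adj H u v

IsInducedSubgraph : {k n : ℕ} → Graph k → Graph n → Set
IsInducedSubgraph H G = InducedEmbedding H G

InducedUniversal : (k : ℕ) {n : ℕ} → Graph n → Set
InducedUniversal k G = (H : Graph k) → IsInducedSubgraph H G

-- Let A be a k-clique and B an independent k-set of G, both induced copies of graphs on k
-- vertices; they share at most one vertex, so |A ∪ B| ≥ 2k − 1. Embed the graph consisting of
-- two disjoint triangles and k − 6 isolated vertices. Each triangle has two vertices in
-- A ∪ B or two outside it; two adjacent vertices of A ∪ B cannot both lie in B, so if both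
-- triangles met A ∪ B twice, each would contain a vertex of A, and these two vertices would
-- be non-adjacent. Hence some edge of G avoids A ∪ B, and by the complementary argument so
-- does some non-edge. An edge and a non-edge have at least three endpoints in total, so
-- G has at least 2k − 1 + 3 vertices.
module Submission where

open import Defs
open import Data.Bool using (Bool; true; false; not; if_then_else_)
open import Data.Bool.Properties using (not-¬)
open import Data.Empty using (⊥-elim)
open import Data.Fin using (Fin; zero; suc; _↑ˡ_; _↑ʳ_; splitAt; punchIn)
open import Data.Fin.Properties
  using (_≟_; any?; ↑ˡ-injective; ↑ʳ-injective; +↔⊎; injective⇒≤; punchIn-injective; punchInᵢ≢i)
open import Data.Nat using (ℕ; suc; _+_; _*_; _≤_; s≤s; z≤n)
open import Data.Nat.Tactic.RingSolver using (solve-∀)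
open import Data.Product using (Σ; ∃; _×_; _,_; proj₁; proj₂; swap)
open import Data.Sum using (_⊎_; inj₁; inj₂; [_,_]′)
open import Function using (_∘_; id)
open import Function.Bundles using (Injection)
open import Function.Definitions using (Injective)
open import Function.Properties.Inverse using (↔⇒↣)
open import Relation.Nullary using (¬_; yes; no; does)
open import Relation.Nullary.Decidable using (dec-true; dec-false)
open import Relation.Binary.PropositionalEquality as ≡ using (_≡_; _≢_; refl; cong; subst)

open InducedEmbedding using (map; injective; preserves)

private
  variable
    k n : ℕ

_∈Im_ : Fin n → (Fin k → Fin n) → Set
y ∈Im f = ∃ λ i → f i ≡ y

Homogeneous : Graph n → Bool → (Fin k → Fin n) → Set
Homogeneous G b f = ∀ i j → i ≢ j → adj G (f i) (f j) ≡ b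

homogeneous-image : (G : Graph n) {b : Bool} {f : Fin k → Fin n} {y y' : Fin n} →
  Homogeneous G b f → y ≢ y' → y ∈Im f → y' ∈Im f → adj G y y' ≡ b
homogeneous-image _ hom y≢y' (i , refl) (j , refl) = hom i j λ { refl → y≢y' refl }

embedding-homogeneous : {H : Graph k} {G : Graph n} {b : Bool} {m : ℕ} {t : Fin m → Fin k} →
  (e : InducedEmbedding H G) → Homogeneous H b t → Homogeneous G b (map e ∘ t)
embedding-homogeneous {t = t} e hom i j i≢j = ≡.trans (preserves e (t i) (t j)) (hom i j i≢j)

offDiagonal : (Fin n → Fin n → Bool) → Fin n → Fin n → Bool
offDiagonal c u v = if does (u ≟ v) then false else c u v

offDiagonal-sym : {c : Fin n → Fin n → Bool} → (∀ u v → c u v ≡ c v u) →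
  ∀ u v → offDiagonal c u v ≡ offDiagonal c v u
offDiagonal-sym c-sym u v with u ≟ v | v ≟ u
... | yes _   | yes _   = refl
... | no _    | no _    = c-sym u v
... | yes u≡v | no v≢u  = ⊥-elim (v≢u (≡.sym u≡v))
... | no u≢v  | yes v≡u = ⊥-elim (u≢v (≡.sym v≡u))

simpleGraph : (c : Fin n → Fin n → Bool) → (∀ u v → c u v ≡ c v u) → Graph n
simpleGraph c c-sym = record
  { adj    = offDiagonal c
  ; sym    = offDiagonal-sym c-sym
  ; irrefl = λ v → cong (λ d → if d then false else c v v) (dec-true (v ≟ v) refl)
  }

simpleGraph-adj : {c : Fin n → Fin n → Bool} (c-sym : ∀ u v → c u v ≡ c v u) {u v : Fin n} →
  u ≢ v → adj (simpleGraph c c-sym) u v ≡ c u v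
simpleGraph-adj {c = c} _ {u} {v} u≢v = cong (λ d → if d then false else c u v) (dec-false (u ≟ v) u≢v)

homogeneousGraph : (k : ℕ) → Bool → Graph k
homogeneousGraph k b = simpleGraph (λ _ _ → b) (λ _ _ → refl)

homogeneousGraph-homogeneous : (b : Bool) → Homogeneous (homogeneousGraph k b) b id
homogeneousGraph-homogeneous _ i j = simpleGraph-adj (λ _ _ → refl)

data Block : Set where
  first second rest : Block

block : {m : ℕ} → Fin (6 + m) → Block
block zero                                   = first
block (suc zero)                             = first
block (suc (suc zero))                       = first
block (suc (suc (suc zero)))                 = second
block (suc (suc (suc (suc zero))))           = second
block (suc (suc (suc (suc (suc zero)))))     = second
block (suc (suc (suc (suc (suc (suc _)))))) = rest

sameTriangle : Block → Block → Bool
sameTriangle first  first  = true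
sameTriangle second second = true
sameTriangle _      _      = false

sameTriangle-sym : ∀ B B' → sameTriangle B B' ≡ sameTriangle B' B
sameTriangle-sym first  first  = refl
sameTriangle-sym first  second = refl
sameTriangle-sym first  rest   = refl
sameTriangle-sym second first  = refl
sameTriangle-sym second second = refl
sameTriangle-sym second rest   = refl
sameTriangle-sym rest   first  = refl
sameTriangle-sym rest   second = refl
sameTriangle-sym rest   rest   = refl

module _ (m : ℕ) (b : Bool) where

  twoTrianglesAdj : Fin (6 + m) → Fin (6 + m) → Bool
  twoTrianglesAdj u v = if sameTriangle (block u) (block v) then b else not b

  twoTrianglesAdj-sym : ∀ u v → twoTrianglesAdj u v ≡ twoTrianglesAdj v u
  twoTrianglesAdj-sym u v = cong (λ s → if s then b else not b) (sameTriangle-sym (block u) (block v))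

  twoTriangles : Graph (6 + m)
  twoTriangles = simpleGraph twoTrianglesAdj twoTrianglesAdj-sym

firstTriangle secondTriangle : {m : ℕ} → Fin 3 → Fin (6 + m)
firstTriangle  {m} i = i ↑ˡ (3 + m)
secondTriangle {m} i = 3 ↑ʳ (i ↑ˡ m)

block-firstTriangle : {m : ℕ} (i : Fin 3) → block {m} (firstTriangle i) ≡ first
block-firstTriangle zero             = refl
block-firstTriangle (suc zero)       = refl
block-firstTriangle (suc (suc zero)) = refl

block-secondTriangle : {m : ℕ} (i : Fin 3) → block {m} (secondTriangle i) ≡ second
block-secondTriangle zero             = refl
block-secondTriangle (suc zero)       = refl
block-secondTriangle (suc (suc zero)) = refl

firstTriangle-injective : {m : ℕ} → Injective _≡_ _≡_ (firstTriangle {m})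
firstTriangle-injective {m} = ↑ˡ-injective (3 + m) _ _

secondTriangle-injective : {m : ℕ} → Injective _≡_ _≡_ (secondTriangle {m})
secondTriangle-injective {m} = ↑ˡ-injective m _ _ ∘ ↑ʳ-injective 3 _ _

firstTriangle≢secondTriangle : {m : ℕ} (i j : Fin 3) → firstTriangle {m} i ≢ secondTriangle j
firstTriangle≢secondTriangle i j e
  with () ← ≡.trans (≡.sym (block-firstTriangle i)) (≡.trans (cong block e) (block-secondTriangle j))

module _ {m : ℕ} {b : Bool} where

  firstTriangle-homogeneous : Homogeneous (twoTriangles m b) b firstTriangle
  firstTriangle-homogeneous i j i≢j
    rewrite simpleGraph-adj (twoTrianglesAdj-sym m b) (i≢j ∘ firstTriangle-injective)
          | block-firstTriangle {m} i | block-firstTriangle {m} j = refl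

  secondTriangle-homogeneous : Homogeneous (twoTriangles m b) b secondTriangle
  secondTriangle-homogeneous i j i≢j
    rewrite simpleGraph-adj (twoTrianglesAdj-sym m b) (i≢j ∘ secondTriangle-injective)
          | block-secondTriangle {m} i | block-secondTriangle {m} j = refl

  twoTriangles-across : ∀ i j → adj (twoTriangles m b) (firstTriangle i) (secondTriangle j) ≡ not b
  twoTriangles-across i j
    rewrite simpleGraph-adj (twoTrianglesAdj-sym m b) (firstTriangle≢secondTriangle i j)
          | block-firstTriangle {m} i | block-secondTriangle {m} j = refl

Outside : (fX fY : Fin k → Fin n) → Fin n → Set
Outside fX fY y = ¬ y ∈Im fX × ¬ y ∈Im fY

record OutsideEdge (G : Graph n) (fX fY : Fin k → Fin n) (b : Bool) : Set where
  constructor outsideEdge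
  field
    {u v}     : Fin n
    u≢v       : u ≢ v
    u~v       : adj G u v ≡ b
    u-outside : Outside fX fY u
    v-outside : Outside fX fY v

module _ {G : Graph n} {b : Bool} {fX fY : Fin k → Fin n}
         (X-hom : Homogeneous G b fX) (Y-hom : Homogeneous G (not b) fY) where

  private
    Covered : Fin n → Set
    Covered y = y ∈Im fX ⊎ y ∈Im fY

    outside-or-covered : ∀ y → Outside fX fY y ⊎ Covered y
    outside-or-covered y with any? (λ i → fX i ≟ y) | any? (λ i → fY i ≟ y)
    ... | yes y∈X | _       = inj₂ (inj₁ y∈X)
    ... | no _    | yes y∈Y = inj₂ (inj₂ y∈Y)
    ... | no y∉X  | no y∉Y  = inj₁ (y∉X , y∉Y)

    b-edge-meets-X : {y y' : Fin n} → y ≢ y' → adj G y y' ≡ b →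
      Covered y → Covered y' → y ∈Im fX ⊎ y' ∈Im fX
    b-edge-meets-X _ _ (inj₁ y∈X) _ = inj₁ y∈X
    b-edge-meets-X _ _ (inj₂ _) (inj₁ y'∈X) = inj₂ y'∈X
    b-edge-meets-X y≢y' y~y' (inj₂ y∈Y) (inj₂ y'∈Y) =
      ⊥-elim (not-¬ y~y' (homogeneous-image G Y-hom y≢y' y∈Y y'∈Y))

  module _ (t : Fin 3 → Fin n) (t-inj : Injective _≡_ _≡_ t) (t-hom : Homogeneous G b t) where

    private
      edge : ∀ i j → i ≢ j → Outside fX fY (t i) → Outside fX fY (t j) → OutsideEdge G fX fY b
      edge i j i≢j = outsideEdge (i≢j ∘ t-inj) (t-hom i j i≢j)

      meetsX : ∀ i j → i ≢ j → Covered (t i) → Covered (t j) → ∃ λ l → t l ∈Im fX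
      meetsX i j i≢j cᵢ cⱼ = [ (i ,_) , (j ,_) ]′ (b-edge-meets-X (i≢j ∘ t-inj) (t-hom i j i≢j) cᵢ cⱼ)

    -- Pigeonhole: two of the three corners are outside, or two are covered.
    triangle-outside-or-meets-X : OutsideEdge G fX fY b ⊎ ∃ λ i → t i ∈Im fX
    triangle-outside-or-meets-X
      with outside-or-covered (t zero) | outside-or-covered (t (suc zero)) | outside-or-covered (t (suc (suc zero)))
    ... | inj₁ o₀ | inj₁ o₁ | _       = inj₁ (edge zero (suc zero) (λ ()) o₀ o₁)
    ... | inj₁ o₀ | inj₂ _  | inj₁ o₂ = inj₁ (edge zero (suc (suc zero)) (λ ()) o₀ o₂)
    ... | inj₂ _  | inj₁ o₁ | inj₁ o₂ = inj₁ (edge (suc zero) (suc (suc zero)) (λ ()) o₁ o₂)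
    ... | inj₁ _  | inj₂ c₁ | inj₂ c₂ = inj₂ (meetsX (suc zero) (suc (suc zero)) (λ ()) c₁ c₂)
    ... | inj₂ c₀ | inj₁ _  | inj₂ c₂ = inj₂ (meetsX zero (suc (suc zero)) (λ ()) c₀ c₂)
    ... | inj₂ c₀ | inj₂ c₁ | _       = inj₂ (meetsX zero (suc zero) (λ ()) c₀ c₁)

  outsideEdge-from-twoTriangles : {m : ℕ} → InducedEmbedding (twoTriangles m b) G → OutsideEdge G fX fY b
  outsideEdge-from-twoTriangles {m} e
    with triangle-outside-or-meets-X (map e ∘ firstTriangle)
           (firstTriangle-injective ∘ injective e) (embedding-homogeneous e firstTriangle-homogeneous)
       | triangle-outside-or-meets-X (map e ∘ secondTriangle)
           (secondTriangle-injective ∘ injective e) (embedding-homogeneous e secondTriangle-homogeneous)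
  ... | inj₁ uv      | _             = uv
  ... | inj₂ _       | inj₁ uv       = uv
  ... | inj₂ (i , x) | inj₂ (j , x') =
    ⊥-elim (not-¬ (homogeneous-image G X-hom (firstTriangle≢secondTriangle i j ∘ injective e) x x')
                  (≡.trans (preserves e (firstTriangle i) (secondTriangle j)) (twoTriangles-across {m} i j)))

_⊕_ : {a c : ℕ} → (Fin a → Fin n) → (Fin c → Fin n) → Fin (a + c) → Fin n
_⊕_ {a = a} f g = [ f , g ]′ ∘ splitAt a

module _ {a c : ℕ} {f : Fin a → Fin n} {g : Fin c → Fin n} where

  ⊕-injective : Injective _≡_ _≡_ f → Injective _≡_ _≡_ g → (∀ i j → f i ≢ g j) →
    Injective _≡_ _≡_ (f ⊕ g)
  ⊕-injective f-inj g-inj f≢g = Injection.injective (↔⇒↣ (+↔⊎ {a} {c})) ∘ [,]-injective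
    where
    [,]-injective : Injective _≡_ _≡_ [ f , g ]′
    [,]-injective {inj₁ i} {inj₁ j} e = cong inj₁ (f-inj e)
    [,]-injective {inj₂ i} {inj₂ j} e = cong inj₂ (g-inj e)
    [,]-injective {inj₁ i} {inj₂ j} e = ⊥-elim (f≢g i j e)
    [,]-injective {inj₂ i} {inj₁ j} e = ⊥-elim (f≢g j i (≡.sym e))

  ⊕-disjoint : {d : ℕ} {h : Fin d → Fin n} → (∀ i j → f i ≢ h j) → (∀ i j → g i ≢ h j) →
    ∀ i j → (f ⊕ g) i ≢ h j
  ⊕-disjoint f≢h g≢h i j with splitAt a i
  ... | inj₁ i' = f≢h i' j
  ... | inj₂ i' = g≢h i' j

module _ {a : ℕ} (G : Graph n) {fA fB : Fin (suc a) → Fin n}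
         (A-hom : Homogeneous G true fA) (B-hom : Homogeneous G false fB) where

  clique-meets-independent-at-most-once : Injective _≡_ _≡_ fB →
    Σ (Fin (suc a)) λ p → ∀ j → j ≢ p → ¬ fB j ∈Im fA
  clique-meets-independent-at-most-once B-inj with any? (λ j → any? (λ i → fA i ≟ fB j))
  ... | no none       = zero , λ j _ j∈A → none (j , j∈A)
  ... | yes (p , p∈A) = p , λ j j≢p j∈A →
    not-¬ (homogeneous-image G A-hom (j≢p ∘ B-inj) j∈A p∈A) (B-hom j p j≢p)

  clique-independent-bound : {c : ℕ} → Injective _≡_ _≡_ fA → Injective _≡_ _≡_ fB →
    (Σ (Fin c → Fin n) λ v → Injective _≡_ _≡_ v × ∀ t → Outside fA fB (v t)) →
    suc a + a + c ≤ n
  clique-independent-bound A-inj B-inj (v , v-inj , v-outside)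
    with clique-meets-independent-at-most-once B-inj
  ... | p , B∉A = injective⇒≤ (⊕-injective (⊕-injective A-inj B'-inj A≢B') v-inj
                                 (⊕-disjoint (λ i t e → proj₁ (v-outside t) (i , e))
                                             (λ i t e → proj₂ (v-outside t) (punchIn p i , e))))
    where
    B'-inj : Injective _≡_ _≡_ (fB ∘ punchIn p)
    B'-inj = punchIn-injective p _ _ ∘ B-inj

    A≢B' : ∀ i j → fA i ≢ fB (punchIn p j)
    A≢B' i j e = B∉A (punchIn p j) (punchInᵢ≢i p j) (i , e)

edge-nonEdge-endpoint : (G : Graph n) {y y' w w' : Fin n} →
  adj G y y' ≡ true → adj G w w' ≡ false → w ≢ w' →
  (w ≢ y × w ≢ y') ⊎ (w' ≢ y × w' ≢ y')
edge-nonEdge-endpoint G {y} {y'} {w} {w'} y~y' w≁w' w≢w' with w ≟ y | w ≟ y' | w' ≟ y | w' ≟ y'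
... | no w≢y   | no w≢y'  | _         | _          = inj₁ (w≢y , w≢y')
... | _        | _        | no w'≢y   | no w'≢y'   = inj₂ (w'≢y , w'≢y')
... | yes refl | _        | yes refl  | _          = ⊥-elim (w≢w' refl)
... | _        | yes refl | _         | yes refl   = ⊥-elim (w≢w' refl)
... | yes refl | _        | _         | yes refl   = ⊥-elim (not-¬ y~y' w≁w')
... | _        | yes refl | yes refl  | _          = ⊥-elim (not-¬ y~y' (≡.trans (Graph.sym G y y') w≁w'))

triple : {A : Set} → A → A → A → Fin 3 → A
triple x y z zero             = x
triple x y z (suc zero)       = y
triple x y z (suc (suc zero)) = z

triple-injective : {x y z : Fin n} → x ≢ y → z ≢ x → z ≢ y → Injective _≡_ _≡_ (triple x y z)
triple-injective x≢y z≢x z≢y {zero}             {zero}             _ = refl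
triple-injective x≢y z≢x z≢y {zero}             {suc zero}         e = ⊥-elim (x≢y e)
triple-injective x≢y z≢x z≢y {zero}             {suc (suc zero)}   e = ⊥-elim (z≢x (≡.sym e))
triple-injective x≢y z≢x z≢y {suc zero}         {zero}             e = ⊥-elim (x≢y (≡.sym e))
triple-injective x≢y z≢x z≢y {suc zero}         {suc zero}         _ = refl
triple-injective x≢y z≢x z≢y {suc zero}         {suc (suc zero)}   e = ⊥-elim (z≢y (≡.sym e))
triple-injective x≢y z≢x z≢y {suc (suc zero)}   {zero}             e = ⊥-elim (z≢x e)
triple-injective x≢y z≢x z≢y {suc (suc zero)}   {suc zero}         e = ⊥-elim (z≢y e)
triple-injective x≢y z≢x z≢y {suc (suc zero)}   {suc (suc zero)}   _ = refl

triple-all : {A : Set} {P : A → Set} {x y z : A} → P x → P y → P z → ∀ t → P (triple x y z t)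
triple-all px py pz zero             = px
triple-all px py pz (suc zero)       = py
triple-all px py pz (suc (suc zero)) = pz

three-outside-vertices : {G : Graph n} {fA fB : Fin k → Fin n} →
  OutsideEdge G fA fB true → OutsideEdge G fB fA false →
  Σ (Fin 3 → Fin n) λ v → Injective _≡_ _≡_ v × ∀ t → Outside fA fB (v t)
three-outside-vertices {G = G} {fA} {fB}
  (outsideEdge y≢y' y~y' y-out y'-out) (outsideEdge w≢w' w≁w' w-out w'-out)
  with edge-nonEdge-endpoint G y~y' w≁w' w≢w'
... | inj₁ (w≢y , w≢y') =
  _ , triple-injective y≢y' w≢y w≢y' , triple-all {P = Outside fA fB} y-out y'-out (swap w-out)
... | inj₂ (w'≢y , w'≢y') =
  _ , triple-injective y≢y' w'≢y w'≢y' , triple-all {P = Outside fA fB} y-out y'-out (swap w'-out)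

proposition1 : (k : ℕ) → 6 ≤ k → (n : ℕ) → (G : Graph n) →
    InducedUniversal k G → 2 * k + 2 ≤ n
proposition1 .(6 + m) (s≤s (s≤s (s≤s (s≤s (s≤s (s≤s (z≤n {m}))))))) n G universal =
  subst (_≤ n) (vertex-count (5 + m))
    (clique-independent-bound G A-hom B-hom (injective A) (injective B)
      (three-outside-vertices
        (outsideEdge-from-twoTriangles A-hom B-hom (universal (twoTriangles m true)))
        (outsideEdge-from-twoTriangles B-hom A-hom (universal (twoTriangles m false)))))
  where
  A : InducedEmbedding (homogeneousGraph (6 + m) true) G
  A = universal (homogeneousGraph (6 + m) true)

  B : InducedEmbedding (homogeneousGraph (6 + m) false) G
  B = universal (homogeneousGraph (6 + m) false)

  A-hom : Homogeneous G true (map A)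
  A-hom = embedding-homogeneous A (homogeneousGraph-homogeneous true)

  B-hom : Homogeneous G false (map B)
  B-hom = embedding-homogeneous B (homogeneousGraph-homogeneous false)

  vertex-count : ∀ a → suc a + a + 3 ≡ 2 * suc a + 2
  vertex-count = solve-∀
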